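{- Let $G=(V,E)$ be a finite simple bipartite graph, let $S\subseteq V$ be a local maximum stable set of $G$, and let $M$ be a maximum matching in the induced subgraph $G[N[S]]$, where $N[S]=S\cup N(S)$. Then there exists a maximum matching $M_0$ of $G$ with $M\subseteq M_0$.
   Context: For $A\subseteq V$, $N(A)=\{v\in V-A : N(v)\cap A\neq\emptyset\}$ and $N[A]=A\cup N(A)$. A stable set is a set of pairwise non-adjacent vertices. A set $A\subseteq V(G)$ is a local maximum stable set of $G$ if $A$ is a maximum stable set of the induced subgraph $G[N[A]]$. -}

module Defs where

open import Data.Nat using (ℕ; _≤_)
open import Data.Bool using (Bool; true; false; T)
open import Data.Fin using (Fin)
open import Data.Fin.Subset using (Subset; _∈_; _∉_; _⊆_; ∣_∣)
open import Data.Product using (_×_; _,_; ∃; ∃-syntax; Σ)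
open import Data.Sum using (_⊎_)
open import Data.List using (List; []; _∷_; length; concatMap)
open import Data.List.Relation.Unary.All using (All)
open import Data.List.Relation.Unary.Unique.Propositional using (Unique)
import Data.List.Membership.Propositional as LM
open import Relation.Binary.PropositionalEquality using (_≡_)
open import Relation.Nullary using (¬_)
open import Data.Bool using (not)
open import Data.Unit using (⊤)

record Graph (n : ℕ) : Set where
  field
    adj       : Fin n → Fin n → Bool
    adj-sym   : ∀ u v → adj u v ≡ adj v u
    adj-irrefl : ∀ v → adj v v ≡ false

open Graph public

Adj : ∀ {n} → Graph n → Fin n → Fin n → Set
Adj G u v = T (adj G u v)

Bipartite : ∀ {n} → Graph n → Set
Bipartite {n} G = Σ (Fin n → Bool) (λ c → ∀ (u v : Fin n) → Adj G u v → c u ≡ not (c v))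

Stable : ∀ {n} → Graph n → Subset n → Set
Stable G A = ∀ u v → u ∈ A → v ∈ A → ¬ Adj G u v

InClosedNbhd : ∀ {n} → Graph n → Subset n → Fin n → Set
InClosedNbhd G A v = v ∈ A ⊎ ∃[ a ] (a ∈ A × Adj G v a)

-- A is a local maximum stable set: A is a maximum stable set of G[N[A]].
-- (A ⊆ N[A] automatically; stable sets of G[N[A]] are the stable sets of G inside N[A].)
LocalMaxStable : ∀ {n} → Graph n → Subset n → Set
LocalMaxStable {n} G A =
  Stable G A ×
  (∀ (B : Subset n) → Stable G B → (∀ v → v ∈ B → InClosedNbhd G A v) → ∣ B ∣ ≤ ∣ A ∣)

Edge : ℕ → Set
Edge n = Fin n × Fin n

endpoints : ∀ {n} → List (Edge n) → List (Fin n)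
endpoints = concatMap (λ { (u , v) → u ∷ v ∷ [] })

-- A matching of the induced subgraph G[X] (X given as a predicate on vertices):
-- every listed pair is an edge of G with both ends in X, and all endpoints are
-- pairwise distinct (so edges are pairwise disjoint, and no edge is listed twice).
MatchingIn : ∀ {n} → Graph n → (Fin n → Set) → List (Edge n) → Set
MatchingIn G X M =
  All (λ { (u , v) → Adj G u v × X u × X v }) M × Unique (endpoints M)

Everywhere : ∀ {n} → Fin n → Set
Everywhere _ = ⊤

MaxMatchingIn : ∀ {n} → Graph n → (Fin n → Set) → List (Edge n) → Set
MaxMatchingIn G X M = MatchingIn G X M × (∀ M' → MatchingIn G X M' → length M' ≤ length M)

_⊆ᴱ_ : ∀ {n} → List (Edge n) → List (Edge n) → Set
M ⊆ᴱ M₀ = All (λ { (u , v) → (u , v) LM.∈ M₀ ⊎ (v , u) LM.∈ M₀ }) M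

-- Let N be the set of neighbours of S outside S. A stable X ⊆ N has at least ∣ X ∣ neighbours
-- in S: replacing them in S by X yields a stable subset of N[S], which is no larger than S.
-- When G is bipartite, every B ⊆ N splits into two stable colour classes whose neighbourhoods
-- in S are disjoint, so Hall's condition holds and N can be matched into S; hence a maximum
-- matching M of G[N[S]] has at least ∣ N ∣ edges. An edge of G that misses N lies outside N[S],
-- so every matching of G has at most ∣ N ∣ + ∣ R ∣ edges, R a maximum matching of G − N[S].
-- Thus M ∪ R, a matching because N[S] and its complement are disjoint, is maximum.

module Submission where

open import Defs
open import Data.Bool using (Bool; true; false; not; T)
open import Data.Bool.Properties using (not-¬; ¬-not)
import Data.Bool.Properties as Bool
open import Data.Empty using (⊥-elim)
open import Data.Fin using (Fin; zero; suc; _≟_)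
open import Data.Fin.Properties using (any?)
import Data.Fin.Properties as Fin
open import Data.Fin.Subset
  using (Subset; _∈_; _∉_; _⊆_; ∣_∣; _∪_; _∩_; _─_; _-_; ⁅_⁆; ∁; Empty; Nonempty)
open import Data.Fin.Subset.Properties
open import Data.List
  using (List; []; _∷_; length; map; filter; _++_; concatMap; cartesianProduct; allFin)
open import Data.List.Membership.Propositional using () renaming (_∈_ to _∈ˡ_)
open import Data.List.Membership.Propositional.Properties
  using (∈-map⁻; ∈-map⁺; ∈-concatMap⁺; ∈-cartesianProduct⁺; ∈-allFin; ∈-filter⁺; ∈-++⁺ˡ)
open import Data.List.Properties using (length-map; length-++)
open import Data.List.Relation.Unary.All as All using (All; []; _∷_)
import Data.List.Relation.Unary.All.Properties as All
open import Data.List.Relation.Unary.Any as Any using (here; there)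
open import Data.List.Relation.Unary.AllPairs using ([]; _∷_)
open import Data.List.Relation.Unary.Unique.Propositional using (Unique)
import Data.List.Relation.Unary.Unique.Propositional.Properties as Unique
import Data.List.Relation.Unary.Unique.DecPropositional as UniqueDec
open import Data.List.Extrema.Nat using (argmax; argmax-all; f[xs]≤f[argmax])
open import Data.Nat using (ℕ; zero; suc; _+_; _≤_; _<_; z≤n; s≤s)
open import Data.Nat.Properties hiding (_≟_)
open import Data.Product using (_×_; _,_; ∃-syntax; proj₁; proj₂)
open import Data.Sum using (_⊎_; inj₁; inj₂)
import Data.Sum as Sum
open import Data.Unit using (tt)
open import Data.Vec using ([]; _∷_; tabulate; here; there)
open import Data.Vec.Properties using (lookup∘tabulate; []=⇒lookup; lookup⇒[]=)
open import Function using (id; _∘_; const)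
open import Relation.Binary.PropositionalEquality
open import Relation.Nullary using (¬_; Dec; yes; no; does; contradiction)
open import Relation.Nullary.Decidable using (_×-dec_; _⊎-dec_; ¬?; T?; dec-true)
open import Relation.Unary using (Pred; Decidable)
open import Relation.Unary.Properties using (∁?)

-- Finite subsets

∣p∪q∣+∣p∩q∣≡∣p∣+∣q∣ : ∀ {n} (p q : Subset n) → ∣ p ∪ q ∣ + ∣ p ∩ q ∣ ≡ ∣ p ∣ + ∣ q ∣
∣p∪q∣+∣p∩q∣≡∣p∣+∣q∣ []         []         = refl
∣p∪q∣+∣p∩q∣≡∣p∣+∣q∣ (true ∷ p)  (true ∷ q)  =
  cong suc (trans (+-suc _ _) (trans (cong suc (∣p∪q∣+∣p∩q∣≡∣p∣+∣q∣ p q)) (sym (+-suc _ _))))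
∣p∪q∣+∣p∩q∣≡∣p∣+∣q∣ (true ∷ p)  (false ∷ q) = cong suc (∣p∪q∣+∣p∩q∣≡∣p∣+∣q∣ p q)
∣p∪q∣+∣p∩q∣≡∣p∣+∣q∣ (false ∷ p) (true ∷ q)  =
  trans (cong suc (∣p∪q∣+∣p∩q∣≡∣p∣+∣q∣ p q)) (sym (+-suc _ _))
∣p∪q∣+∣p∩q∣≡∣p∣+∣q∣ (false ∷ p) (false ∷ q) = ∣p∪q∣+∣p∩q∣≡∣p∣+∣q∣ p q

∣p∣≡∣p∩q∣+∣p─q∣ : ∀ {n} (p q : Subset n) → ∣ p ∣ ≡ ∣ p ∩ q ∣ + ∣ p ─ q ∣
∣p∣≡∣p∩q∣+∣p─q∣ []          []          = refl
∣p∣≡∣p∩q∣+∣p─q∣ (true ∷ p)  (true ∷ q)  = cong suc (∣p∣≡∣p∩q∣+∣p─q∣ p q)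
∣p∣≡∣p∩q∣+∣p─q∣ (true ∷ p)  (false ∷ q) = trans (cong suc (∣p∣≡∣p∩q∣+∣p─q∣ p q)) (sym (+-suc _ _))
∣p∣≡∣p∩q∣+∣p─q∣ (false ∷ p) (true ∷ q)  = ∣p∣≡∣p∩q∣+∣p─q∣ p q
∣p∣≡∣p∩q∣+∣p─q∣ (false ∷ p) (false ∷ q) = ∣p∣≡∣p∩q∣+∣p─q∣ p q

∣p∪q∣≤∣p∣+∣q∣ : ∀ {n} (p q : Subset n) → ∣ p ∪ q ∣ ≤ ∣ p ∣ + ∣ q ∣
∣p∪q∣≤∣p∣+∣q∣ p q = ≤-trans (m≤m+n _ _) (≤-reflexive (∣p∪q∣+∣p∩q∣≡∣p∣+∣q∣ p q))

∣p∪q∣≡∣p∣+∣q∣ : ∀ {n} (p q : Subset n) → Empty (p ∩ q) → ∣ p ∪ q ∣ ≡ ∣ p ∣ + ∣ q ∣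
∣p∪q∣≡∣p∣+∣q∣ {n} p q disjoint = begin
  ∣ p ∪ q ∣               ≡⟨ +-identityʳ _ ⟨
  ∣ p ∪ q ∣ + 0           ≡⟨ cong (∣ p ∪ q ∣ +_) ∣p∩q∣≡0 ⟨
  ∣ p ∪ q ∣ + ∣ p ∩ q ∣   ≡⟨ ∣p∪q∣+∣p∩q∣≡∣p∣+∣q∣ p q ⟩
  ∣ p ∣ + ∣ q ∣           ∎
  where
  open ≡-Reasoning
  ∣p∩q∣≡0 : ∣ p ∩ q ∣ ≡ 0
  ∣p∩q∣≡0 = trans (cong ∣_∣ (Empty-unique disjoint)) (∣⊥∣≡0 n)

x∈p─q⇒x∉q : ∀ {n} {p q : Subset n} {x} → x ∈ p ─ q → x ∉ q
x∈p─q⇒x∉q {p = true ∷ p} {false ∷ q} here      ()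
x∈p─q⇒x∉q {p = _ ∷ p}    {_ ∷ q}     (there x∈) (there x∈q) = x∈p─q⇒x∉q x∈ x∈q

0<∣p∣⇒Nonempty : ∀ {n} (p : Subset n) → 0 < ∣ p ∣ → Nonempty p
0<∣p∣⇒Nonempty {n} p 0<∣p∣ with nonempty? p
... | yes p≠∅ = p≠∅
... | no  p=∅ = contradiction (trans (cong ∣_∣ (Empty-unique p=∅)) (∣⊥∣≡0 n)) (≢-sym (<⇒≢ 0<∣p∣))

subset : ∀ {n ℓ} {P : Pred (Fin n) ℓ} → Decidable P → Subset n
subset P? = tabulate (does ∘ P?)

∈-subset⁺ : ∀ {n ℓ} {P : Pred (Fin n) ℓ} (P? : Decidable P) {x} → P x → x ∈ subset P?
∈-subset⁺ P? {x} px = lookup⇒[]= x _ (trans (lookup∘tabulate _ x) (dec-true (P? x) px))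

∈-subset⁻ : ∀ {n ℓ} {P : Pred (Fin n) ℓ} (P? : Decidable P) {x} → x ∈ subset P? → P x
∈-subset⁻ P? {x} x∈ with P? x | trans (sym (lookup∘tabulate (does ∘ P?) x)) ([]=⇒lookup x∈)
... | yes px | _  = px
... | no  _  | ()

elements : ∀ {n} → Subset n → List (Fin n)
elements []          = []
elements (true ∷ p)  = zero ∷ map suc (elements p)
elements (false ∷ p) = map suc (elements p)

length-elements : ∀ {n} (p : Subset n) → length (elements p) ≡ ∣ p ∣
length-elements []          = refl
length-elements (true ∷ p)  = cong suc (trans (length-map suc (elements p)) (length-elements p))
length-elements (false ∷ p) = trans (length-map suc (elements p)) (length-elements p)

∈-elements⁻ : ∀ {n} (p : Subset n) {x} → x ∈ˡ elements p → x ∈ p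
∈-elements⁻ (true ∷ p) (here refl) = here
∈-elements⁻ (true ∷ p) (there x∈) with ∈-map⁻ suc x∈
... | y , y∈ , refl = there (∈-elements⁻ p y∈)
∈-elements⁻ (false ∷ p) x∈ with ∈-map⁻ suc x∈
... | y , y∈ , refl = there (∈-elements⁻ p y∈)

elements-Unique : ∀ {n} (p : Subset n) → Unique (elements p)
elements-Unique []          = []
elements-Unique (true ∷ p)  =
  All.tabulate zero∉ ∷ Unique.map⁺ Fin.suc-injective (elements-Unique p)
  where
  zero∉ : ∀ {x} → x ∈ˡ map suc (elements p) → zero ≢ x
  zero∉ x∈ with ∈-map⁻ suc x∈
  ... | _ , _ , refl = λ ()
elements-Unique (false ∷ p) = Unique.map⁺ Fin.suc-injective (elements-Unique p)

-- Hall's theorem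

module Hall {n} (R : Fin n → Fin n → Set) (R? : ∀ a t → Dec (R a t)) where

  Nbr : Subset n → Subset n → Fin n → Set
  Nbr T B t = t ∈ T × ∃[ b ] (b ∈ B × R b t)

  nbr? : ∀ T B → Decidable (Nbr T B)
  nbr? T B t = t ∈? T ×-dec any? (λ b → b ∈? B ×-dec R? b t)

  nbrs : Subset n → Subset n → Subset n
  nbrs T B = subset (nbr? T B)

  nbrs⁺ : ∀ {T B t b} → t ∈ T → b ∈ B → R b t → t ∈ nbrs T B
  nbrs⁺ {T} {B} t∈T b∈B r = ∈-subset⁺ (nbr? T B) (t∈T , _ , b∈B , r)

  nbrs⁻ : ∀ {T B t} → t ∈ nbrs T B → Nbr T B t
  nbrs⁻ {T} {B} = ∈-subset⁻ (nbr? T B)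

  nbrs⊆ : ∀ T B → nbrs T B ⊆ T
  nbrs⊆ T B = proj₁ ∘ nbrs⁻

  nbrs-mono : ∀ {T B B'} → B ⊆ B' → nbrs T B ⊆ nbrs T B'
  nbrs-mono B⊆B' t∈ with nbrs⁻ t∈
  ... | t∈T , b , b∈B , r = nbrs⁺ t∈T (B⊆B' b∈B) r

  HallCondition : Subset n → Subset n → Set
  HallCondition A T = ∀ B → B ⊆ A → ∣ B ∣ ≤ ∣ nbrs T B ∣

  record MatchingInto (A T : Subset n) : Set where
    field
      mate           : Fin n → Fin n
      mate-∈         : ∀ {a} → a ∈ A → mate a ∈ T
      mate-R         : ∀ {a} → a ∈ A → R a (mate a)
      mate-injective : ∀ {a b} → a ∈ A → b ∈ A → mate a ≡ mate b → a ≡ b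

  matchingInto-empty : ∀ {A T} → Empty A → MatchingInto A T
  matchingInto-empty A=∅ = record
    { mate           = id
    ; mate-∈         = λ a∈A → ⊥-elim (A=∅ (_ , a∈A))
    ; mate-R         = λ a∈A → ⊥-elim (A=∅ (_ , a∈A))
    ; mate-injective = λ a∈A _ _ → ⊥-elim (A=∅ (_ , a∈A))
    }

  matchingInto-⁅⁆ : ∀ {x y} → R x y → MatchingInto ⁅ x ⁆ ⁅ y ⁆
  matchingInto-⁅⁆ {x} {y} r = record
    { mate           = const y
    ; mate-∈         = λ _ → x∈⁅x⁆ y
    ; mate-R         = λ a∈ → subst (λ a → R a y) (sym (x∈⁅y⁆⇒x≡y x a∈)) r
    ; mate-injective = λ a∈ b∈ _ → trans (x∈⁅y⁆⇒x≡y x a∈) (sym (x∈⁅y⁆⇒x≡y x b∈))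
    }

  matchingInto-nbrs : ∀ {B T} → MatchingInto B T → MatchingInto B (nbrs T B)
  matchingInto-nbrs f = record
    { mate           = mate
    ; mate-∈         = λ b∈B → nbrs⁺ (mate-∈ b∈B) b∈B (mate-R b∈B)
    ; mate-R         = mate-R
    ; mate-injective = mate-injective
    }
    where open MatchingInto f

  glue : ∀ {A B T U} → U ⊆ T → MatchingInto B U → MatchingInto (A ─ B) (T ─ U) → MatchingInto A T
  glue {A} {B} {T} {U} U⊆T f g = record
    { mate = mate ; mate-∈ = mate-∈ ; mate-R = mate-R ; mate-injective = mate-injective }
    where
    module f = MatchingInto f
    module g = MatchingInto g

    rest : ∀ {a} → a ∈ A → a ∉ B → a ∈ A ─ B
    rest = x∈p∧x∉q⇒x∈p─q

    separated : ∀ {a b} → a ∈ B → b ∈ A → b ∉ B → f.mate a ≢ g.mate b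
    separated a∈B b∈A b∉B eq =
      x∈p─q⇒x∉q (g.mate-∈ (rest b∈A b∉B)) (subst (_∈ U) eq (f.mate-∈ a∈B))

    mate : Fin n → Fin n
    mate a with a ∈? B
    ... | yes _ = f.mate a
    ... | no  _ = g.mate a

    mate-∈ : ∀ {a} → a ∈ A → mate a ∈ T
    mate-∈ {a} a∈A with a ∈? B
    ... | yes a∈B = U⊆T (f.mate-∈ a∈B)
    ... | no  a∉B = p─q⊆p T U (g.mate-∈ (rest a∈A a∉B))

    mate-R : ∀ {a} → a ∈ A → R a (mate a)
    mate-R {a} a∈A with a ∈? B
    ... | yes a∈B = f.mate-R a∈B
    ... | no  a∉B = g.mate-R (rest a∈A a∉B)

    mate-injective : ∀ {a b} → a ∈ A → b ∈ A → mate a ≡ mate b → a ≡ b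
    mate-injective {a} {b} a∈A b∈A with a ∈? B | b ∈? B
    ... | yes a∈B | yes b∈B = f.mate-injective a∈B b∈B
    ... | no  a∉B | no  b∉B = g.mate-injective (rest a∈A a∉B) (rest b∈A b∉B)
    ... | yes a∈B | no  b∉B = ⊥-elim ∘ separated a∈B b∈A b∉B
    ... | no  a∉B | yes b∈B = ⊥-elim ∘ separated b∈B a∈A a∉B ∘ sym

  ∣nbrs∣≤∣nbrs[T─U]∣+∣U∣ : ∀ T U C → ∣ nbrs T C ∣ ≤ ∣ nbrs (T ─ U) C ∣ + ∣ U ∣
  ∣nbrs∣≤∣nbrs[T─U]∣+∣U∣ T U C = ≤-trans (p⊆q⇒∣p∣≤∣q∣ split) (∣p∪q∣≤∣p∣+∣q∣ (nbrs (T ─ U) C) U)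
    where
    split : nbrs T C ⊆ nbrs (T ─ U) C ∪ U
    split {t} t∈ with t ∈? U | nbrs⁻ t∈
    ... | yes t∈U | _                 = x∈p∪q⁺ (inj₂ t∈U)
    ... | no  t∉U | t∈T , _ , c∈C , r = x∈p∪q⁺ (inj₁ (nbrs⁺ (x∈p∧x∉q⇒x∈p─q t∈T t∉U) c∈C r))

  HallCondition-─critical : ∀ {A T B} → HallCondition A T → B ⊆ A → ∣ nbrs T B ∣ ≤ ∣ B ∣ →
                            HallCondition (A ─ B) (T ─ nbrs T B)
  HallCondition-─critical {A} {T} {B} hall B⊆A critical C C⊆A─B =
    +-cancelʳ-≤ ∣ B ∣ ∣ C ∣ _ (begin
      ∣ C ∣ + ∣ B ∣                        ≡⟨ ∣p∪q∣≡∣p∣+∣q∣ C B C∩B=∅ ⟨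
      ∣ C ∪ B ∣                            ≤⟨ hall (C ∪ B) C∪B⊆A ⟩
      ∣ nbrs T (C ∪ B) ∣                   ≤⟨ ∣nbrs∣≤∣nbrs[T─U]∣+∣U∣ T (nbrs T B) (C ∪ B) ⟩
      ∣ nbrs T' (C ∪ B) ∣ + ∣ nbrs T B ∣    ≤⟨ +-mono-≤ (p⊆q⇒∣p∣≤∣q∣ away-from-B) critical ⟩
      ∣ nbrs T' C ∣ + ∣ B ∣                ∎)
    where
    open ≤-Reasoning

    T' : Subset n
    T' = T ─ nbrs T B

    C∩B=∅ : Empty (C ∩ B)
    C∩B=∅ (x , x∈C∩B) with x∈p∩q⁻ C B x∈C∩B
    ... | x∈C , x∈B = x∈p─q⇒x∉q (C⊆A─B x∈C) x∈B

    C∪B⊆A : C ∪ B ⊆ A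
    C∪B⊆A x∈ with x∈p∪q⁻ C B x∈
    ... | inj₁ x∈C = p─q⊆p A B (C⊆A─B x∈C)
    ... | inj₂ x∈B = B⊆A x∈B

    away-from-B : nbrs T' (C ∪ B) ⊆ nbrs T' C
    away-from-B t∈ with nbrs⁻ t∈
    ... | t∈T' , c , c∈C∪B , r with x∈p∪q⁻ C B c∈C∪B
    ...   | inj₁ c∈C = nbrs⁺ t∈T' c∈C r
    ...   | inj₂ c∈B = ⊥-elim (x∈p─q⇒x∉q t∈T' (nbrs⁺ (p─q⊆p T _ t∈T') c∈B r))

  HallCondition-─⁅⁆ : ∀ {A T y} → (∀ C → C ⊆ A → Nonempty C → ∣ C ∣ < ∣ nbrs T C ∣) →
                      HallCondition A (T ─ ⁅ y ⁆)
  HallCondition-─⁅⁆ {A} {T} {y} surplus C C⊆A with nonempty? C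
  ... | no  C=∅ = ≤-trans (≤-reflexive (trans (cong ∣_∣ (Empty-unique C=∅)) (∣⊥∣≡0 n))) z≤n
  ... | yes C≠∅ = ≤-pred (begin
    suc ∣ C ∣                        ≤⟨ surplus C C⊆A C≠∅ ⟩
    ∣ nbrs T C ∣                     ≤⟨ ∣nbrs∣≤∣nbrs[T─U]∣+∣U∣ T ⁅ y ⁆ C ⟩
    ∣ nbrs (T ─ ⁅ y ⁆) C ∣ + ∣ ⁅ y ⁆ ∣ ≡⟨ cong (∣ nbrs (T ─ ⁅ y ⁆) C ∣ +_) (∣⁅x⁆∣≡1 y) ⟩
    ∣ nbrs (T ─ ⁅ y ⁆) C ∣ + 1       ≡⟨ +-comm ∣ nbrs (T ─ ⁅ y ⁆) C ∣ 1 ⟩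
    suc ∣ nbrs (T ─ ⁅ y ⁆) C ∣       ∎)
    where open ≤-Reasoning

  HallCondition⇒∃R : ∀ {A T x} → HallCondition A T → x ∈ A → ∃[ y ] (y ∈ T × R x y)
  HallCondition⇒∃R {A} {T} {x} hall x∈A with 0<∣p∣⇒Nonempty (nbrs T ⁅ x ⁆) 0<∣nbrs∣
    where
    0<∣nbrs∣ : 0 < ∣ nbrs T ⁅ x ⁆ ∣
    0<∣nbrs∣ = subst (_≤ ∣ nbrs T ⁅ x ⁆ ∣) (∣⁅x⁆∣≡1 x)
                 (hall ⁅ x ⁆ λ a∈ → subst (_∈ A) (sym (x∈⁅y⁆⇒x≡y x a∈)) x∈A)
  ... | y , y∈ with nbrs⁻ y∈
  ...   | y∈T , b , b∈⁅x⁆ , r = y , y∈T , subst (λ b → R b y) (x∈⁅y⁆⇒x≡y x b∈⁅x⁆) r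

  Critical : Subset n → Subset n → Subset n → Set
  Critical A T B = B ⊆ A × Nonempty B × ∣ B ∣ < ∣ A ∣ × ∣ nbrs T B ∣ ≤ ∣ B ∣

  critical? : ∀ A T → Decidable (Critical A T)
  critical? A T B = B ⊆? A ×-dec nonempty? B ×-dec ∣ B ∣ <? ∣ A ∣ ×-dec ∣ nbrs T B ∣ ≤? ∣ B ∣

  -- If some nonempty proper B ⊆ A is critical, match B into its
  -- neighbourhood and A ─ B into the rest of T. Otherwise every such B has more neighbours
  -- than elements, so after matching any x ∈ A to a neighbour y, Hall's condition still holds
  -- for A ─ ⁅ x ⁆ and T ─ ⁅ y ⁆.
  hall-bounded : ∀ k {A T} → ∣ A ∣ ≤ k → HallCondition A T → MatchingInto A T
  hall-bounded zero    ∣A∣≤0 _ =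
    matchingInto-empty λ (_ , x∈A) → n≮0 (<-≤-trans (x∈p⇒∣p-x∣<∣p∣ x∈A) ∣A∣≤0)
  hall-bounded (suc k) {A} {T} ∣A∣≤1+k hall with nonempty? A
  ... | no  A=∅       = matchingInto-empty A=∅
  ... | yes (x , x∈A) with anySubset? (critical? A T)
  ...   | yes (B , B⊆A , (b , b∈B) , ∣B∣<∣A∣ , critical) =
    glue (nbrs⊆ T B)
      (matchingInto-nbrs (hall-bounded k (shrink ∣B∣<∣A∣) λ C C⊆B → hall C (⊆-trans C⊆B B⊆A)))
      (hall-bounded k (shrink (p∩q≢∅⇒∣p─q∣<∣p∣ A B (b , x∈p∩q⁺ (B⊆A b∈B , b∈B))))
        (HallCondition-─critical hall B⊆A critical))
    where
    shrink : ∀ {m} → m < ∣ A ∣ → m ≤ k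
    shrink m<∣A∣ = ≤-pred (≤-trans m<∣A∣ ∣A∣≤1+k)
  ...   | no no-critical with HallCondition⇒∃R hall x∈A
  ...     | y , y∈T , r =
    glue (λ t∈ → subst (_∈ T) (sym (x∈⁅y⁆⇒x≡y y t∈)) y∈T)
      (matchingInto-⁅⁆ r)
      (hall-bounded k (≤-pred (≤-trans ∣A─x∣<∣A∣ ∣A∣≤1+k)) (HallCondition-─⁅⁆ surplus))
    where
    ∣A─x∣<∣A∣ : ∣ A ─ ⁅ x ⁆ ∣ < ∣ A ∣
    ∣A─x∣<∣A∣ = p∩q≢∅⇒∣p─q∣<∣p∣ A ⁅ x ⁆ (x , x∈p∩q⁺ (x∈A , x∈⁅x⁆ x))

    surplus : ∀ C → C ⊆ A ─ ⁅ x ⁆ → Nonempty C → ∣ C ∣ < ∣ nbrs T C ∣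
    surplus C C⊆A─x C≠∅ = ≰⇒> λ ∣nbrs∣≤∣C∣ → no-critical
      (C , p─q⊆p A ⁅ x ⁆ ∘ C⊆A─x , C≠∅ , ≤-<-trans (p⊆q⇒∣p∣≤∣q∣ C⊆A─x) ∣A─x∣<∣A∣ , ∣nbrs∣≤∣C∣)

  hall : ∀ {A T} → HallCondition A T → MatchingInto A T
  hall {A} = hall-bounded ∣ A ∣ ≤-refl

-- Lists of edges

module _ {a p} {A : Set a} {P : Pred A p} (P? : Decidable P) where

  length-filter+filter∁ : ∀ xs → length xs ≡ length (filter P? xs) + length (filter (∁? P?) xs)
  length-filter+filter∁ []       = refl
  length-filter+filter∁ (x ∷ xs) with does (P? x)
  ... | true  = cong suc (length-filter+filter∁ xs)
  ... | false = trans (cong suc (length-filter+filter∁ xs)) (sym (+-suc _ _))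

module _ {a} {A : Set a} where

  lists≤ : List A → ℕ → List (List A)
  lists≤ xs zero    = [] ∷ []
  lists≤ xs (suc k) = [] ∷ concatMap (λ x → map (x ∷_) (lists≤ xs k)) xs

  ∈-lists≤ : ∀ {xs} k {ys} → All (_∈ˡ xs) ys → length ys ≤ k → ys ∈ˡ lists≤ xs k
  ∈-lists≤ zero    {[]}     _           _             = here refl
  ∈-lists≤ (suc k) {[]}     _           _             = here refl
  ∈-lists≤ (suc k) {y ∷ ys} (y∈ ∷ ys∈) (s≤s ∣ys∣≤k) =
    there (∈-concatMap⁺ (λ x → map (x ∷_) (lists≤ _ k))
             (Any.map (λ { refl → ∈-map⁺ (y ∷_) (∈-lists≤ k ys∈ ∣ys∣≤k) }) y∈))

Meets : ∀ {n} → Subset n → Edge n → Set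
Meets U (u , v) = u ∈ U ⊎ v ∈ U

meets? : ∀ {n} (U : Subset n) → Decidable (Meets U)
meets? U (u , v) = u ∈? U ⊎-dec v ∈? U

All-Meets-─ : ∀ {n} {U : Subset n} {w} L → All (w ≢_) (endpoints L) → All (Meets U) L →
              All (Meets (U - w)) L
All-Meets-─ []            _                   []               = []
All-Meets-─ ((a , b) ∷ L) (w≢a ∷ w≢b ∷ w∉L) (meets ∷ meetsL) =
  Sum.map (λ a∈U → x∈p∧x≢y⇒x∈p-y a∈U (≢-sym w≢a)) (λ b∈U → x∈p∧x≢y⇒x∈p-y b∈U (≢-sym w≢b)) meets
    ∷ All-Meets-─ L w∉L meetsL

length≤∣cover∣ : ∀ {n} {U : Subset n} L → Unique (endpoints L) → All (Meets U) L → length L ≤ ∣ U ∣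
length≤∣cover∣ []            _                  _                = z≤n
length≤∣cover∣ ((u , v) ∷ L) (u∉ ∷ v∉ ∷ unique) (meets ∷ meetsL) with meets
... | inj₁ u∈U =
  ≤-trans (s≤s (length≤∣cover∣ L unique (All-Meets-─ L (All.tail u∉) meetsL))) (x∈p⇒∣p-x∣<∣p∣ u∈U)
... | inj₂ v∈U =
  ≤-trans (s≤s (length≤∣cover∣ L unique (All-Meets-─ L v∉ meetsL))) (x∈p⇒∣p-x∣<∣p∣ v∈U)

endpoints-++ : ∀ {n} (L K : List (Edge n)) → endpoints (L ++ K) ≡ endpoints L ++ endpoints K
endpoints-++ []            K = refl
endpoints-++ ((u , v) ∷ L) K = cong (λ E → u ∷ v ∷ E) (endpoints-++ L K)

module _ {n p} {P : Pred (Edge n) p} (P? : Decidable P) where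

  endpoints-filter⊆ : ∀ L {z} → z ∈ˡ endpoints (filter P? L) → z ∈ˡ endpoints L
  endpoints-filter⊆ ((u , v) ∷ L) with does (P? (u , v))
  ... | true  = λ { (here refl)         → here refl
                  ; (there (here refl)) → there (here refl)
                  ; (there (there z∈))  → there (there (endpoints-filter⊆ L z∈)) }
  ... | false = λ z∈ → there (there (endpoints-filter⊆ L z∈))

  Unique-endpoints-filter : ∀ L → Unique (endpoints L) → Unique (endpoints (filter P? L))
  Unique-endpoints-filter []            _                  = []
  Unique-endpoints-filter ((u , v) ∷ L) (u∉ ∷ v∉ ∷ unique) with does (P? (u , v))
  ... | true  = (All.head u∉ ∷ All.anti-mono (endpoints-filter⊆ L) (All.tail u∉))
              ∷ All.anti-mono (endpoints-filter⊆ L) v∉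
              ∷ Unique-endpoints-filter L unique
  ... | false = Unique-endpoints-filter L unique

module _ {n} (f : Fin n → Fin n) where

  graph : List (Fin n) → List (Edge n)
  graph = map (λ a → a , f a)

  ∈-endpoints-graph⁻ : ∀ xs {z} → z ∈ˡ endpoints (graph xs) → ∃[ b ] (b ∈ˡ xs × (z ≡ b ⊎ z ≡ f b))
  ∈-endpoints-graph⁻ (a ∷ xs) (here refl)         = a , here refl , inj₁ refl
  ∈-endpoints-graph⁻ (a ∷ xs) (there (here refl)) = a , here refl , inj₂ refl
  ∈-endpoints-graph⁻ (a ∷ xs) (there (there z∈)) with ∈-endpoints-graph⁻ xs z∈
  ... | b , b∈ , z≡ = b , there b∈ , z≡

  Unique-endpoints-graph : ∀ xs → Unique xs → (∀ {a b} → a ∈ˡ xs → b ∈ˡ xs → a ≢ f b) →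
                           (∀ {a b} → a ∈ˡ xs → b ∈ˡ xs → f a ≡ f b → a ≡ b) →
                           Unique (endpoints (graph xs))
  Unique-endpoints-graph []       _                _   _         = []
  Unique-endpoints-graph (a ∷ xs) (a∉xs ∷ unique) a≢fb injective =
    (a≢fb (here refl) (here refl) ∷ All.tabulate a∉) ∷ All.tabulate fa∉
      ∷ Unique-endpoints-graph xs unique (λ a∈ b∈ → a≢fb (there a∈) (there b∈))
                                         (λ a∈ b∈ → injective (there a∈) (there b∈))
    where
    a∉ : ∀ {z} → z ∈ˡ endpoints (graph xs) → a ≢ z
    a∉ z∈ with ∈-endpoints-graph⁻ xs z∈
    ... | b , b∈ , inj₁ refl = All.lookup a∉xs b∈
    ... | b , b∈ , inj₂ refl = a≢fb (here refl) (there b∈)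

    fa∉ : ∀ {z} → z ∈ˡ endpoints (graph xs) → f a ≢ z
    fa∉ z∈ with ∈-endpoints-graph⁻ xs z∈
    ... | b , b∈ , inj₁ refl = a≢fb (there b∈) (here refl) ∘ sym
    ... | b , b∈ , inj₂ refl = All.lookup a∉xs b∈ ∘ injective (here refl) (there b∈)

-- Matchings

module _ {n : ℕ} (G : Graph n) where

  Adj? : ∀ u v → Dec (Adj G u v)
  Adj? u v = T? (adj G u v)

  Adj-sym : ∀ {u v} → Adj G u v → Adj G v u
  Adj-sym {u} {v} = subst T (adj-sym G u v)

  MatchingIn? : ∀ {X : Fin n → Set} → Decidable X → Decidable (MatchingIn G X)
  MatchingIn? X? L =
    All.all? (λ { (u , v) → Adj? u v ×-dec X? u ×-dec X? v }) L
      ×-dec UniqueDec.unique? _≟_ (endpoints L)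

  MatchingIn-mono : ∀ {X Y : Fin n → Set} {L} → (∀ {v} → X v → Y v) →
                    MatchingIn G X L → MatchingIn G Y L
  MatchingIn-mono X⊆Y (edges , unique) =
    All.map (λ { {u , v} (a , Xu , Xv) → a , X⊆Y Xu , X⊆Y Xv }) edges , unique

  endpoints-in : ∀ {X : Fin n → Set} L → MatchingIn G X L → All X (endpoints L)
  endpoints-in []            _                                    = []
  endpoints-in ((u , v) ∷ L) ((_ , Xu , Xv) ∷ edges , _ ∷ _ ∷ unique) =
    Xu ∷ Xv ∷ endpoints-in L (edges , unique)

  MatchingIn-filter : ∀ {X : Fin n → Set} {p} {P : Pred (Edge n) p} (P? : Decidable P) {L} →
                      MatchingIn G X L → MatchingIn G X (filter P? L)
  MatchingIn-filter P? {L} (edges , unique) =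
    All.filter⁺ P? edges , Unique-endpoints-filter P? L unique

  MatchingIn-++ : ∀ {X Y : Fin n → Set} {M K} → (∀ {v} → X v → ¬ Y v) →
                  MatchingIn G X M → MatchingIn G Y K → MatchingIn G (λ v → X v ⊎ Y v) (M ++ K)
  MatchingIn-++ {M = M} {K} X∩Y=∅ m k =
    All.++⁺ (proj₁ (MatchingIn-mono inj₁ m)) (proj₁ (MatchingIn-mono inj₂ k)) ,
    subst Unique (sym (endpoints-++ M K)) (Unique.++⁺ (proj₂ m) (proj₂ k) disjoint)
    where
    disjoint : ∀ {v} → ¬ (v ∈ˡ endpoints M × v ∈ˡ endpoints K)
    disjoint (v∈M , v∈K) =
      X∩Y=∅ (All.lookup (endpoints-in M m) v∈M) (All.lookup (endpoints-in K k) v∈K)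

  length≤n : ∀ {X : Fin n → Set} {L} → MatchingIn G X L → length L ≤ n
  length≤n {L = L} (_ , unique) =
    subst (length L ≤_) (∣⊤∣≡n n) (length≤∣cover∣ L unique (All.universal (λ _ → inj₁ ∈⊤) L))

  maximumMatching : ∀ {X : Fin n → Set} → Decidable X → ∃[ M ] MaxMatchingIn G X M
  maximumMatching {X} X? = M , M-matching , M-maximum
    where
    allEdges : List (Edge n)
    allEdges = cartesianProduct (allFin n) (allFin n)

    candidates : List (List (Edge n))
    candidates = filter (MatchingIn? X?) (lists≤ allEdges n)

    M : List (Edge n)
    M = argmax length [] candidates

    M-matching : MatchingIn G X M
    M-matching = argmax-all length ([] , []) (All.all-filter (MatchingIn? X?) (lists≤ allEdges n))

    M-maximum : ∀ M' → MatchingIn G X M' → length M' ≤ length M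
    M-maximum M' m' = All.lookup (f[xs]≤f[argmax] {f = length} [] candidates)
      (∈-filter⁺ (MatchingIn? X?) (∈-lists≤ n (All.universal ∈-allEdges M') (length≤n m')) m')
      where
      ∈-allEdges : ∀ e → e ∈ˡ allEdges
      ∈-allEdges (u , v) = ∈-cartesianProduct⁺ (∈-allFin u) (∈-allFin v)

  length≤∣cover∣+max : ∀ {U : Subset n} {X Y : Fin n → Set} {L R} →
                       (∀ {u v} → Adj G u v → u ∉ U → v ∉ U → Y u) →
                       MaxMatchingIn G Y R → MatchingIn G X L → length L ≤ ∣ U ∣ + length R
  length≤∣cover∣+max {U} {X} {Y} {L} {R} uncovered⇒Y (_ , R-max) m = begin
    length L                                   ≡⟨ length-filter+filter∁ (meets? U) L ⟩
    length (filter (meets? U) L) + length rest ≤⟨ +-mono-≤ covered-≤ (R-max rest uncovered) ⟩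
    ∣ U ∣ + length R                           ∎
    where
    open ≤-Reasoning

    rest : List (Edge n)
    rest = filter (∁? (meets? U)) L

    covered-≤ : length (filter (meets? U) L) ≤ ∣ U ∣
    covered-≤ =
      length≤∣cover∣ _ (proj₂ (MatchingIn-filter (meets? U) m)) (All.all-filter (meets? U) L)

    uncovered : MatchingIn G Y rest
    uncovered with MatchingIn-filter (∁? (meets? U)) m
    ... | edges , unique =
      All.zipWith (λ {e} → in-Y) (edges , All.all-filter (∁? (meets? U)) L) , unique
      where
      in-Y : ∀ {u v} → (Adj G u v × X u × X v) × ¬ Meets U (u , v) → Adj G u v × Y u × Y v
      in-Y ((u~v , _ , _) , ¬meets) =
        u~v , uncovered⇒Y u~v (¬meets ∘ inj₁) (¬meets ∘ inj₂)
            , uncovered⇒Y (Adj-sym u~v) (¬meets ∘ inj₂) (¬meets ∘ inj₁)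

  open Hall (Adj G) Adj? using (MatchingInto; module MatchingInto)

  MatchingInto⇒MatchingIn : ∀ {A T} → Empty (A ∩ T) → MatchingInto A T →
                            ∃[ L ] (MatchingIn G (λ v → v ∈ A ⊎ v ∈ T) L × length L ≡ ∣ A ∣)
  MatchingInto⇒MatchingIn {A} {T} A∩T=∅ f =
    graph mate (elements A) , matching , trans (length-map _ (elements A)) (length-elements A)
    where
    open MatchingInto f

    in-A : ∀ {a} → a ∈ˡ elements A → a ∈ A
    in-A = ∈-elements⁻ A

    unique : Unique (endpoints (graph mate (elements A)))
    unique = Unique-endpoints-graph mate (elements A) (elements-Unique A)
      (λ a∈ b∈ a≡fb → A∩T=∅ (_ , x∈p∩q⁺ (in-A a∈ , subst (_∈ T) (sym a≡fb) (mate-∈ (in-A b∈)))))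
      (λ a∈ b∈ → mate-injective (in-A a∈) (in-A b∈))

    matching : MatchingIn G (λ v → v ∈ A ⊎ v ∈ T) (graph mate (elements A))
    matching =
      All.map⁺ (All.tabulate λ a∈ → mate-R (in-A a∈) , inj₁ (in-A a∈) , inj₂ (mate-∈ (in-A a∈))) , unique

-- Local maximum stable sets

module LocalMaximumStable {n} (G : Graph n) {S : Subset n} (S-lms : LocalMaxStable G S) where

  open Hall (Adj G) (Adj? G)

  N : Subset n
  N = nbrs (∁ S) S

  N∪S⊆N[S] : ∀ {v} → v ∈ N ⊎ v ∈ S → InClosedNbhd G S v
  N∪S⊆N[S] (inj₁ v∈N) with nbrs⁻ v∈N
  ... | _ , a , a∈S , a~v = inj₂ (a , a∈S , Adj-sym G a~v)
  N∪S⊆N[S] (inj₂ v∈S) = inj₁ v∈S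

  N∩S=∅ : Empty (N ∩ S)
  N∩S=∅ (v , v∈N∩S) with x∈p∩q⁻ N S v∈N∩S
  ... | v∈N , v∈S = x∈∁p⇒x∉p (nbrs⊆ (∁ S) S v∈N) v∈S

  Stable-swap : ∀ {X} → Stable G X → Stable G ((S ─ nbrs S X) ∪ X)
  Stable-swap {X} X-stable u v u∈ v∈ u~v
    with x∈p∪q⁻ (S ─ nbrs S X) X u∈ | x∈p∪q⁻ (S ─ nbrs S X) X v∈
  ... | inj₁ u∈S' | inj₁ v∈S' = proj₁ S-lms u v (p─q⊆p S _ u∈S') (p─q⊆p S _ v∈S') u~v
  ... | inj₁ u∈S' | inj₂ v∈X  = x∈p─q⇒x∉q u∈S' (nbrs⁺ (p─q⊆p S _ u∈S') v∈X (Adj-sym G u~v))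
  ... | inj₂ u∈X  | inj₁ v∈S' = x∈p─q⇒x∉q v∈S' (nbrs⁺ (p─q⊆p S _ v∈S') u∈X u~v)
  ... | inj₂ u∈X  | inj₂ v∈X  = X-stable u v u∈X v∈X u~v

  ∣X∣≤∣nbrs∣ : ∀ {X} → X ⊆ N → Stable G X → ∣ X ∣ ≤ ∣ nbrs S X ∣
  ∣X∣≤∣nbrs∣ {X} X⊆N X-stable = +-cancelˡ-≤ (∣ S ─ Sₓ ∣) (∣ X ∣) (∣ Sₓ ∣) (begin
    ∣ S ─ Sₓ ∣ + ∣ X ∣        ≡⟨ ∣p∪q∣≡∣p∣+∣q∣ (S ─ Sₓ) X disjoint ⟨
    ∣ (S ─ Sₓ) ∪ X ∣         ≤⟨ proj₂ S-lms _ (Stable-swap X-stable) swapped⊆N[S] ⟩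
    ∣ S ∣                    ≡⟨ trans (∣p∣≡∣p∩q∣+∣p─q∣ S Sₓ) (+-comm (∣ S ∩ Sₓ ∣) (∣ S ─ Sₓ ∣)) ⟩
    ∣ S ─ Sₓ ∣ + ∣ S ∩ Sₓ ∣   ≤⟨ +-monoʳ-≤ (∣ S ─ Sₓ ∣) (∣p∩q∣≤∣q∣ S Sₓ) ⟩
    ∣ S ─ Sₓ ∣ + ∣ Sₓ ∣       ∎)
    where
    open ≤-Reasoning

    Sₓ : Subset n
    Sₓ = nbrs S X

    disjoint : Empty ((S ─ Sₓ) ∩ X)
    disjoint (v , v∈) with x∈p∩q⁻ (S ─ Sₓ) X v∈
    ... | v∈S─Sₓ , v∈X = N∩S=∅ (v , x∈p∩q⁺ (X⊆N v∈X , p─q⊆p S Sₓ v∈S─Sₓ))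

    swapped⊆N[S] : ∀ v → v ∈ (S ─ Sₓ) ∪ X → InClosedNbhd G S v
    swapped⊆N[S] v v∈ with x∈p∪q⁻ (S ─ Sₓ) X v∈
    ... | inj₁ v∈S─Sₓ = inj₁ (p─q⊆p S Sₓ v∈S─Sₓ)
    ... | inj₂ v∈X    = N∪S⊆N[S] (inj₁ (X⊆N v∈X))

  Outside : Fin n → Set
  Outside v = ¬ InClosedNbhd G S v

  outside? : Decidable Outside
  outside? v = ¬? (v ∈? S ⊎-dec any? λ a → a ∈? S ×-dec Adj? G v a)

  uncovered⇒Outside : ∀ {u v} → Adj G u v → u ∉ N → v ∉ N → Outside u
  uncovered⇒Outside {u} {v} u~v u∉N v∉N u∈N[S] with u ∈? S
  ... | yes u∈S = v∉N (nbrs⁺ (x∉p⇒x∈∁p λ v∈S → proj₁ S-lms u v u∈S v∈S u~v) u∈S u~v)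
  ... | no  u∉S with u∈N[S]
  ...   | inj₁ u∈S          = u∉S u∈S
  ...   | inj₂ (a , a∈S , u~a) = u∉N (nbrs⁺ (x∉p⇒x∈∁p u∉S) a∈S (Adj-sym G u~a))

  length≤∣N∣+max : ∀ {X R L} → MaxMatchingIn G Outside R → MatchingIn G X L →
                   length L ≤ ∣ N ∣ + length R
  length≤∣N∣+max = length≤∣cover∣+max G uncovered⇒Outside

  module Coloured (colour : Fin n → Bool)
                  (proper : ∀ u v → Adj G u v → colour u ≡ not (colour v)) where

    Stable-monochromatic : ∀ {X γ} → (∀ {x} → x ∈ X → colour x ≡ γ) → Stable G X
    Stable-monochromatic {γ = γ} monochromatic u v u∈X v∈X u~v =
      not-¬ {γ} refl
        (trans (sym (monochromatic u∈X)) (trans (proper u v u~v) (cong not (monochromatic v∈X))))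

    common-nbr⇒same-colour : ∀ {b b' t} → Adj G b t → Adj G b' t → colour b ≡ colour b'
    common-nbr⇒same-colour {b} {b'} {t} b~t b'~t = trans (proper b t b~t) (sym (proper b' t b'~t))

    HallCondition-N : HallCondition N S
    HallCondition-N B B⊆N = begin
      ∣ B ∣                 ≡⟨ ∣p∣≡∣p∩q∣+∣p─q∣ B C ⟩
      ∣ B ∩ C ∣ + ∣ B ─ C ∣   ≤⟨ +-mono-≤ (∣X∣≤∣nbrs∣ (B⊆N ∘ p∩q⊆p B C) (Stable-monochromatic colour-true))
                                        (∣X∣≤∣nbrs∣ (B⊆N ∘ p─q⊆p B C) (Stable-monochromatic colour-false)) ⟩
      ∣ Nᵗ ∣ + ∣ Nᶠ ∣         ≡⟨ ∣p∪q∣≡∣p∣+∣q∣ Nᵗ Nᶠ disjoint ⟨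
      ∣ Nᵗ ∪ Nᶠ ∣            ≤⟨ p⊆q⇒∣p∣≤∣q∣ Nᵗ∪Nᶠ⊆nbrs ⟩
      ∣ nbrs S B ∣          ∎
      where
      open ≤-Reasoning

      true? : Decidable (λ x → colour x ≡ true)
      true? x = colour x Bool.≟ true

      C Nᵗ Nᶠ : Subset n
      C  = subset true?
      Nᵗ = nbrs S (B ∩ C)
      Nᶠ = nbrs S (B ─ C)

      colour-true : ∀ {x} → x ∈ B ∩ C → colour x ≡ true
      colour-true = ∈-subset⁻ true? ∘ p∩q⊆q B C

      colour-false : ∀ {x} → x ∈ B ─ C → colour x ≡ false
      colour-false x∈ = ¬-not (x∈p─q⇒x∉q x∈ ∘ ∈-subset⁺ true?)

      disjoint : Empty (Nᵗ ∩ Nᶠ)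
      disjoint (t , t∈) with x∈p∩q⁻ Nᵗ Nᶠ t∈
      ... | t∈Nᵗ , t∈Nᶠ with nbrs⁻ t∈Nᵗ | nbrs⁻ t∈Nᶠ
      ...   | _ , b , b∈ , b~t | _ , b' , b'∈ , b'~t = contradiction
        (trans (sym (colour-true b∈)) (trans (common-nbr⇒same-colour b~t b'~t) (colour-false b'∈))) λ ()

      Nᵗ∪Nᶠ⊆nbrs : Nᵗ ∪ Nᶠ ⊆ nbrs S B
      Nᵗ∪Nᶠ⊆nbrs t∈ with x∈p∪q⁻ Nᵗ Nᶠ t∈
      ... | inj₁ t∈Nᵗ = nbrs-mono (p∩q⊆p B C) t∈Nᵗ
      ... | inj₂ t∈Nᶠ = nbrs-mono (p─q⊆p B C) t∈Nᶠ

    ∣N∣≤max : ∀ {M} → MaxMatchingIn G (InClosedNbhd G S) M → ∣ N ∣ ≤ length M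
    ∣N∣≤max {M} (_ , M-max) with MatchingInto⇒MatchingIn G N∩S=∅ (hall HallCondition-N)
    ... | L , L-matching , ∣L∣≡∣N∣ =
      subst (_≤ length M) ∣L∣≡∣N∣ (M-max L (MatchingIn-mono G N∪S⊆N[S] L-matching))

corollary2 : ∀ {n : ℕ} (G : Graph n) → Bipartite G →
    (S : Subset n) → LocalMaxStable G S →
    (M : List (Edge n)) → MaxMatchingIn G (InClosedNbhd G S) M →
    ∃[ M₀ ] (MaxMatchingIn G Everywhere M₀ × M ⊆ᴱ M₀)
corollary2 {n} G (colour , proper) S S-lms M M-max@(M-matching , _) =
  M ++ R , (M++R-matching , M++R-max) , All.tabulate (inj₁ ∘ ∈-++⁺ˡ)
  where
  open LocalMaximumStable G S-lms
  open Coloured colour proper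

  R : List (Edge n)
  R = proj₁ (maximumMatching G outside?)

  R-max : MaxMatchingIn G Outside R
  R-max = proj₂ (maximumMatching G outside?)

  M++R-matching : MatchingIn G Everywhere (M ++ R)
  M++R-matching = MatchingIn-mono G (const tt)
    (MatchingIn-++ G (λ in-N[S] outside → outside in-N[S]) M-matching (proj₁ R-max))

  M++R-max : ∀ M' → MatchingIn G Everywhere M' → length M' ≤ length (M ++ R)
  M++R-max M' M'-matching = begin
    length M'           ≤⟨ length≤∣N∣+max R-max M'-matching ⟩
    ∣ N ∣ + length R     ≤⟨ +-monoˡ-≤ (length R) (∣N∣≤max M-max) ⟩
    length M + length R ≡⟨ length-++ M ⟨
    length (M ++ R)     ∎
    where open ≤-Reasoning
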